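{- For any finite sets $A,B\subseteq X$, the following are equivalent: (i) $\epsilon\in[\![t_B]\!]_{\sigma_A}$; (ii) $B\subseteq A$; (iii) $t_A\leqq t_B$; (iv) $t_A\lesssim t_B$.
   Context: Fix a set $X$ of variables. Expressions $\mathcal E(X)$ are generated by $e,f::= x \mid 0\mid 1\mid e+f\mid e\cdot f\mid e\cap f\mid e^+\mid \overline{e}$. For a finite $A=\{a_1,\dots,a_n\}\subseteq X$ (any order), $t_A=a_1\cap(a_2\cap(\cdots\cap(a_n\cap 1)\cdots))$, $t_\emptyset=1$. Semantics: for an alphabet $\Sigma$ and $\sigma:X\to\mathcal P(\Sigma^\star)$, $[\![x]\!]_\sigma=\sigma(x)$, $[\![0]\!]_\sigma=\emptyset$, $[\![1]\!]_\sigma=\{\epsilon\}$, $+$ union, $\cap$ intersection, $\cdot$ concatenation, $e^+$ is $\bigcup_{n\ge1}[\![e]\!]_\sigma^n$, $\overline e$ the set of reversed words. $\sigma_A:X\to\mathcal P(\Sigma^\star)$ (any alphabet) maps $x$ to $\{\epsilon\}$ if $x\in A$ and to $\emptyset$ otherwise. $e\lesssim f$ means $[\![e]\!]_\sigma\subseteq[\![f]\!]_\sigma$ for all $\Sigma,\sigma$. $e\leqq f$ means $e+f\equiv f$, where $\equiv$ is the smallest congruence on $\mathcal E(X)$ containing, for all $e,f,g$: $e+f=f+e$; $e+(f+g)=(e+f)+g$; $e+0=e$; $e\cap f=f\cap e$; $e\cap e=e$; $e\cap(f\cap g)=(e\cap f)\cap g$; $(e+f)\cap g=e\cap g+f\cap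 g$; $(e\cap f)+e=e$; $e\cdot(f\cdot g)=(e\cdot f)\cdot g$; $e\cdot 0=0=0\cdot e$; $(e+f)\cdot g=e\cdot g+f\cdot g$; $e\cdot(f+g)=e\cdot f+e\cdot g$; $e^+=e+e\cdot e^+$; $e^+=e+e^+\cdot e$; $\overline{\overline e}=e$; $\overline{e+f}=\overline e+\overline f$; $\overline{e\cdot f}=\overline f\cdot\overline e$; $\overline{e\cap f}=\overline e\cap\overline f$; $\overline{e^+}=\overline e^{\,+}$; $1\cdot e=e=e\cdot 1$; $1\cap(e\cdot f)=1\cap(e\cap f)$; $1\cap\overline e=1\cap e$; $(1\cap e)\cdot f=f\cdot(1\cap e)$; $((1\cap e)\cdot f)\cap g=(1\cap e)\cdot(f\cap g)$; $(g+(1\cap e)\cdot f)^+=g^++(1\cap e)\cdot(g+f)^+$; and closed under: if $e\cdot f+f\equiv f$ then $e^+\cdot f+f\equiv f$; if $f\cdot e+f\equiv f$ then $f\cdot e^++f\equiv f$. -}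

module Defs where

open import Data.List using (List; []; _∷_; _++_; reverse)
open import Data.List.Membership.Propositional using (_∈_)
open import Data.Product using (Σ; _×_; ∃; ∃-syntax; _,_)
open import Data.Sum using (_⊎_)
open import Data.Empty using (⊥)
open import Relation.Binary.PropositionalEquality using (_≡_)

data Expr (X : Set) : Set where
  var  : X → Expr X
  𝟘 𝟙  : Expr X
  _⊕_  : Expr X → Expr X → Expr X
  _⊙_  : Expr X → Expr X → Expr X
  _⊓_  : Expr X → Expr X → Expr X
  _⁺   : Expr X → Expr X
  conv : Expr X → Expr X

infixl 6 _⊕_
infixl 7 _⊙_
infixl 8 _⊓_

-- t_A for a finite set A given as a list a₁,…,aₙ (in some order)
t : {X : Set} → List X → Expr X
t []      = 𝟙
t (a ∷ A) = var a ⊓ t A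

Lang : Set → Set₁
Lang S = List S → Set

data Plus {S : Set} (L : Lang S) : Lang S where
  one  : ∀ {w} → L w → Plus L w
  more : ∀ {u v} → L u → Plus L v → Plus L (u ++ v)

⟦_⟧ : {X S : Set} → Expr X → (X → Lang S) → Lang S
⟦ var x ⟧ σ w = σ x w
⟦ 𝟘 ⟧ σ w = ⊥
⟦ 𝟙 ⟧ σ w = w ≡ []
⟦ e ⊕ f ⟧ σ w = ⟦ e ⟧ σ w ⊎ ⟦ f ⟧ σ w
⟦ e ⊙ f ⟧ σ w = ∃[ u ] ∃[ v ] (w ≡ u ++ v × ⟦ e ⟧ σ u × ⟦ f ⟧ σ v)
⟦ e ⊓ f ⟧ σ w = ⟦ e ⟧ σ w × ⟦ f ⟧ σ w
⟦ e ⁺ ⟧ σ w = Plus (⟦ e ⟧ σ) w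
⟦ conv e ⟧ σ w = ⟦ e ⟧ σ (reverse w)

σ[_] : {X S : Set} → List X → X → Lang S
σ[ A ] x w = (x ∈ A) × (w ≡ [])

_≲_ : {X : Set} → Expr X → Expr X → Set₁
_≲_ {X} e f = (S : Set) (σ : X → Lang S) (w : List S) → ⟦ e ⟧ σ w → ⟦ f ⟧ σ w

infix 4 _≈_
data _≈_ {X : Set} : Expr X → Expr X → Set where
  ≈-refl  : ∀ {e} → e ≈ e
  ≈-sym   : ∀ {e f} → e ≈ f → f ≈ e
  ≈-trans : ∀ {e f g} → e ≈ f → f ≈ g → e ≈ g
  ⊕-cong  : ∀ {e e' f f'} → e ≈ e' → f ≈ f' → e ⊕ f ≈ e' ⊕ f'
  ⊙-cong  : ∀ {e e' f f'} → e ≈ e' → f ≈ f' → e ⊙ f ≈ e' ⊙ f'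
  ⊓-cong  : ∀ {e e' f f'} → e ≈ e' → f ≈ f' → e ⊓ f ≈ e' ⊓ f'
  ⁺-cong  : ∀ {e e'} → e ≈ e' → e ⁺ ≈ e' ⁺
  conv-cong : ∀ {e e'} → e ≈ e' → conv e ≈ conv e'
  ⊕-comm   : ∀ {e f} → e ⊕ f ≈ f ⊕ e
  ⊕-assoc  : ∀ {e f g} → e ⊕ (f ⊕ g) ≈ (e ⊕ f) ⊕ g
  ⊕-zero   : ∀ {e} → e ⊕ 𝟘 ≈ e
  ⊓-comm   : ∀ {e f} → e ⊓ f ≈ f ⊓ e
  ⊓-idem   : ∀ {e} → e ⊓ e ≈ e
  ⊓-assoc  : ∀ {e f g} → e ⊓ (f ⊓ g) ≈ (e ⊓ f) ⊓ g
  ⊓-distr  : ∀ {e f g} → (e ⊕ f) ⊓ g ≈ e ⊓ g ⊕ f ⊓ g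
  absorb   : ∀ {e f} → (e ⊓ f) ⊕ e ≈ e
  ⊙-assoc  : ∀ {e f g} → e ⊙ (f ⊙ g) ≈ (e ⊙ f) ⊙ g
  ⊙-zeroʳ  : ∀ {e} → e ⊙ 𝟘 ≈ 𝟘
  ⊙-zeroˡ  : ∀ {e} → 𝟘 ⊙ e ≈ 𝟘
  ⊙-distrʳ : ∀ {e f g} → (e ⊕ f) ⊙ g ≈ e ⊙ g ⊕ f ⊙ g
  ⊙-distrˡ : ∀ {e f g} → e ⊙ (f ⊕ g) ≈ e ⊙ f ⊕ e ⊙ g
  ⁺-unfoldˡ : ∀ {e} → e ⁺ ≈ e ⊕ e ⊙ e ⁺
  ⁺-unfoldʳ : ∀ {e} → e ⁺ ≈ e ⊕ e ⁺ ⊙ e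
  conv-inv  : ∀ {e} → conv (conv e) ≈ e
  conv-⊕    : ∀ {e f} → conv (e ⊕ f) ≈ conv e ⊕ conv f
  conv-⊙    : ∀ {e f} → conv (e ⊙ f) ≈ conv f ⊙ conv e
  conv-⊓    : ∀ {e f} → conv (e ⊓ f) ≈ conv e ⊓ conv f
  conv-⁺    : ∀ {e} → conv (e ⁺) ≈ (conv e) ⁺
  ⊙-unitˡ   : ∀ {e} → 𝟙 ⊙ e ≈ e
  ⊙-unitʳ   : ∀ {e} → e ⊙ 𝟙 ≈ e
  𝟙⊓⊙       : ∀ {e f} → 𝟙 ⊓ (e ⊙ f) ≈ 𝟙 ⊓ (e ⊓ f)
  𝟙⊓conv    : ∀ {e} → 𝟙 ⊓ conv e ≈ 𝟙 ⊓ e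
  test-comm : ∀ {e f} → (𝟙 ⊓ e) ⊙ f ≈ f ⊙ (𝟙 ⊓ e)
  test-⊓    : ∀ {e f g} → ((𝟙 ⊓ e) ⊙ f) ⊓ g ≈ (𝟙 ⊓ e) ⊙ (f ⊓ g)
  test-⁺    : ∀ {e f g} → (g ⊕ (𝟙 ⊓ e) ⊙ f) ⁺ ≈ g ⁺ ⊕ (𝟙 ⊓ e) ⊙ (g ⊕ f) ⁺
  ind-l : ∀ {e f} → e ⊙ f ⊕ f ≈ f → e ⁺ ⊙ f ⊕ f ≈ f
  ind-r : ∀ {e f} → f ⊙ e ⊕ f ≈ f → f ⊙ e ⁺ ⊕ f ≈ f

_≦_ : {X : Set} → Expr X → Expr X → Set
e ≦ f = e ⊕ f ≈ f

-- Semantically, t_A denotes {ε} if ε ∈ σ(a) for every a ∈ A, and ∅ otherwise;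
-- hence (i) ⇔ (ii), (ii) ⇒ (iv), and (iv) ⇒ (i) by instantiating σ := σ_A.
-- Syntactically, B ⊆ A gives t_B ∩ t_A ≡ t_A by idempotence of ∩, whence
-- t_A ≦ t_B by absorption. Conversely, ≡ is sound for the two-valued
-- interpretation "ε belongs to e under σ_A", in which t_A holds and t_B holds
-- only if B ⊆ A; so (iii) ⇒ (ii).
module Submission where

open import Defs
open import Data.List using (List; []; _∷_)
open import Data.List.Membership.Propositional using (_∈_)
open import Data.List.Relation.Binary.Subset.Propositional using (_⊆_)
open import Data.List.Relation.Binary.Subset.Propositional.Properties using (⊆-refl)
open import Data.List.Relation.Unary.All as All using (All; []; _∷_)
open import Data.List.Relation.Unary.All.Properties using (anti-mono)
open import Data.List.Relation.Unary.Any using (here; there)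
open import Data.List.Relation.Unary.Unique.Propositional using (Unique)
open import Data.Empty using (⊥)
open import Data.Unit using (⊤; tt)
open import Data.Product using (_×_; _,_; proj₁; proj₂; map₂; <_,_>)
open import Data.Product.Algebra using (×-comm; ×-assoc; ×-distribˡ-⊎; ×-distribʳ-⊎)
open import Data.Product.Function.NonDependent.Propositional using (_×-⇔_)
open import Data.Sum as Sum using (_⊎_; inj₁; inj₂; [_,_])
open import Data.Sum.Algebra using (⊎-comm; ⊎-assoc)
open import Data.Sum.Function.Propositional using (_⊎-⇔_)
open import Function using (id; _∘_)
open import Function.Bundles using (_⇔_; mk⇔; module Equivalence)
open import Function.Properties.Equivalence renaming (refl to ⇔-refl; sym to ⇔-sym; trans to ⇔-trans)
open import Function.Properties.Inverse using (↔⇒⇔)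
open import Level using (0ℓ)
open import Relation.Binary.Bundles using (Setoid)
open import Relation.Binary.PropositionalEquality using (_≡_; refl)
import Relation.Binary.Reasoning.Setoid as SetoidReasoning

module _ {X : Set} where

  ⟦t⟧⇒ : ∀ {S} {σ : X → Lang S} {w} (A : List X) →
         ⟦ t A ⟧ σ w → w ≡ [] × All (λ a → σ a w) A
  ⟦t⟧⇒ []      w≡[]          = w≡[] , []
  ⟦t⟧⇒ (a ∷ A) (σaw , ⟦tA⟧w) = map₂ (σaw ∷_) (⟦t⟧⇒ A ⟦tA⟧w)

  ⟦t⟧⇐ : ∀ {S} {σ : X → Lang S} {w} {A : List X} →
         w ≡ [] → All (λ a → σ a w) A → ⟦ t A ⟧ σ w
  ⟦t⟧⇐ w≡[] []          = w≡[]
  ⟦t⟧⇐ w≡[] (σaw ∷ σAw) = σaw , ⟦t⟧⇐ w≡[] σAw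

  ε∈⟦t⟧σ[_]⇔⊆ : ∀ {S} (A : List X) {B : List X} → ⟦ t B ⟧ (σ[_] {X} {S} A) [] ⇔ B ⊆ A
  ε∈⟦t⟧σ[ A ]⇔⊆ {B} = mk⇔
    (λ ε∈tB {_} b∈B → proj₁ (All.lookup (proj₂ (⟦t⟧⇒ B ε∈tB)) b∈B))
    (λ B⊆A → ⟦t⟧⇐ refl (All.tabulate (λ b∈B → B⊆A b∈B , refl)))

  ⊆⇒≲ : {A B : List X} → B ⊆ A → t A ≲ t B
  ⊆⇒≲ {A} B⊆A S σ w ⟦tA⟧w with ⟦t⟧⇒ A ⟦tA⟧w
  ... | w≡[] , σAw = ⟦t⟧⇐ w≡[] (anti-mono B⊆A σAw)

  ≲⇒⊆ : {A B : List X} → t A ≲ t B → B ⊆ A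
  ≲⇒⊆ {A} tA≲tB = Equivalence.to ε∈⟦t⟧σ[ A ]⇔⊆
    (tA≲tB ⊤ σ[ A ] [] (Equivalence.from ε∈⟦t⟧σ[ A ]⇔⊆ ⊆-refl))

  ≈-setoid : Setoid 0ℓ 0ℓ
  ≈-setoid = record
    { Carrier       = Expr X
    ; _≈_           = _≈_
    ; isEquivalence = record { refl = ≈-refl ; sym = ≈-sym ; trans = ≈-trans }
    }

  open SetoidReasoning ≈-setoid

  x⊓z≈z⇒x⊓[y⊓z]≈y⊓z : ∀ {e f g} → e ⊓ f ≈ f → e ⊓ (g ⊓ f) ≈ g ⊓ f
  x⊓z≈z⇒x⊓[y⊓z]≈y⊓z {e} {f} {g} e⊓f≈f = begin
    e ⊓ (g ⊓ f)  ≈⟨ ⊓-assoc ⟩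
    (e ⊓ g) ⊓ f  ≈⟨ ⊓-cong ⊓-comm ≈-refl ⟩
    (g ⊓ e) ⊓ f  ≈⟨ ≈-sym ⊓-assoc ⟩
    g ⊓ (e ⊓ f)  ≈⟨ ⊓-cong ≈-refl e⊓f≈f ⟩
    g ⊓ f        ∎

  var⊓t≈t : ∀ {a} A → a ∈ A → var a ⊓ t A ≈ t A
  var⊓t≈t (a ∷ A) (here refl) = begin
    var a ⊓ (var a ⊓ t A)  ≈⟨ ⊓-assoc ⟩
    (var a ⊓ var a) ⊓ t A  ≈⟨ ⊓-cong ⊓-idem ≈-refl ⟩
    var a ⊓ t A            ∎
  var⊓t≈t (a ∷ A) (there b∈A) = x⊓z≈z⇒x⊓[y⊓z]≈y⊓z (var⊓t≈t A b∈A)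

  𝟙⊓t≈t : ∀ A → 𝟙 ⊓ t A ≈ t A
  𝟙⊓t≈t []      = ⊓-idem
  𝟙⊓t≈t (a ∷ A) = x⊓z≈z⇒x⊓[y⊓z]≈y⊓z (𝟙⊓t≈t A)

  ⊆⇒t⊓t≈t : ∀ {A} B → B ⊆ A → t B ⊓ t A ≈ t A
  ⊆⇒t⊓t≈t {A} []      _   = 𝟙⊓t≈t A
  ⊆⇒t⊓t≈t {A} (b ∷ B) B⊆A = begin
    (var b ⊓ t B) ⊓ t A  ≈⟨ ≈-sym ⊓-assoc ⟩
    var b ⊓ (t B ⊓ t A)  ≈⟨ ⊓-cong ≈-refl (⊆⇒t⊓t≈t B (B⊆A ∘ there)) ⟩
    var b ⊓ t A          ≈⟨ var⊓t≈t A (B⊆A (here refl)) ⟩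
    t A                  ∎

  ⊆⇒≦ : {A B : List X} → B ⊆ A → t A ≦ t B
  ⊆⇒≦ {A} {B} B⊆A = begin
    t A ⊕ t B          ≈⟨ ⊕-cong (≈-sym (⊆⇒t⊓t≈t B B⊆A)) ≈-refl ⟩
    (t B ⊓ t A) ⊕ t B  ≈⟨ absorb ⟩
    t B                ∎

  -- Nullable A e is, up to ⇔, the proposition ε ∈ ⟦ e ⟧ σ[ A ]; as ε ∈ L⁺
  -- iff ε ∈ L, the induction rules hold trivially in this model.
  Nullable : List X → Expr X → Set
  Nullable A (var x)  = x ∈ A
  Nullable A 𝟘        = ⊥
  Nullable A 𝟙        = ⊤
  Nullable A (e ⊕ f)  = Nullable A e ⊎ Nullable A f
  Nullable A (e ⊙ f)  = Nullable A e × Nullable A f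
  Nullable A (e ⊓ f)  = Nullable A e × Nullable A f
  Nullable A (e ⁺)    = Nullable A e
  Nullable A (conv e) = Nullable A e

  ≈⇒Nullable⇔ : ∀ A {e f} → e ≈ f → Nullable A e ⇔ Nullable A f
  ≈⇒Nullable⇔ A ≈-refl        = ⇔-refl
  ≈⇒Nullable⇔ A (≈-sym p)     = ⇔-sym (≈⇒Nullable⇔ A p)
  ≈⇒Nullable⇔ A (≈-trans p q) = ⇔-trans (≈⇒Nullable⇔ A p) (≈⇒Nullable⇔ A q)
  ≈⇒Nullable⇔ A (⊕-cong p q)  = ≈⇒Nullable⇔ A p ⊎-⇔ ≈⇒Nullable⇔ A q
  ≈⇒Nullable⇔ A (⊙-cong p q)  = ≈⇒Nullable⇔ A p ×-⇔ ≈⇒Nullable⇔ A q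
  ≈⇒Nullable⇔ A (⊓-cong p q)  = ≈⇒Nullable⇔ A p ×-⇔ ≈⇒Nullable⇔ A q
  ≈⇒Nullable⇔ A (⁺-cong p)    = ≈⇒Nullable⇔ A p
  ≈⇒Nullable⇔ A (conv-cong p) = ≈⇒Nullable⇔ A p
  ≈⇒Nullable⇔ A ⊕-comm        = ↔⇒⇔ (⊎-comm _ _)
  ≈⇒Nullable⇔ A ⊕-assoc       = ⇔-sym (↔⇒⇔ (⊎-assoc 0ℓ _ _ _))
  ≈⇒Nullable⇔ A ⊕-zero        = mk⇔ [ id , (λ ()) ] inj₁
  ≈⇒Nullable⇔ A ⊓-comm        = ↔⇒⇔ (×-comm _ _)
  ≈⇒Nullable⇔ A ⊓-idem        = mk⇔ proj₁ < id , id >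
  ≈⇒Nullable⇔ A ⊓-assoc       = ⇔-sym (↔⇒⇔ (×-assoc 0ℓ _ _ _))
  ≈⇒Nullable⇔ A ⊓-distr       = ↔⇒⇔ (×-distribʳ-⊎ 0ℓ _ _ _)
  ≈⇒Nullable⇔ A absorb        = mk⇔ [ proj₁ , id ] inj₂
  ≈⇒Nullable⇔ A ⊙-assoc       = ⇔-sym (↔⇒⇔ (×-assoc 0ℓ _ _ _))
  ≈⇒Nullable⇔ A ⊙-zeroʳ       = mk⇔ proj₂ (λ ())
  ≈⇒Nullable⇔ A ⊙-zeroˡ       = mk⇔ proj₁ (λ ())
  ≈⇒Nullable⇔ A ⊙-distrʳ      = ↔⇒⇔ (×-distribʳ-⊎ 0ℓ _ _ _)
  ≈⇒Nullable⇔ A ⊙-distrˡ      = ↔⇒⇔ (×-distribˡ-⊎ 0ℓ _ _ _)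
  ≈⇒Nullable⇔ A ⁺-unfoldˡ     = mk⇔ inj₁ [ id , proj₁ ]
  ≈⇒Nullable⇔ A ⁺-unfoldʳ     = mk⇔ inj₁ [ id , proj₁ ]
  ≈⇒Nullable⇔ A conv-inv      = ⇔-refl
  ≈⇒Nullable⇔ A conv-⊕        = ⇔-refl
  ≈⇒Nullable⇔ A conv-⊙        = ↔⇒⇔ (×-comm _ _)
  ≈⇒Nullable⇔ A conv-⊓        = ⇔-refl
  ≈⇒Nullable⇔ A conv-⁺        = ⇔-refl
  ≈⇒Nullable⇔ A ⊙-unitˡ       = mk⇔ proj₂ (tt ,_)
  ≈⇒Nullable⇔ A ⊙-unitʳ       = mk⇔ proj₁ (_, tt)
  ≈⇒Nullable⇔ A 𝟙⊓⊙           = ⇔-refl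
  ≈⇒Nullable⇔ A 𝟙⊓conv        = ⇔-refl
  ≈⇒Nullable⇔ A test-comm     = ↔⇒⇔ (×-comm _ _)
  ≈⇒Nullable⇔ A test-⊓        = ↔⇒⇔ (×-assoc 0ℓ _ _ _)
  ≈⇒Nullable⇔ A test-⁺        = mk⇔ (Sum.map₂ (map₂ inj₂))
    [ inj₁ , (λ { (_ , inj₁ ε∈g) → inj₁ ε∈g ; (ε∈𝟙⊓e , inj₂ ε∈f) → inj₂ (ε∈𝟙⊓e , ε∈f) }) ]
  ≈⇒Nullable⇔ A (ind-l p)     = ≈⇒Nullable⇔ A p
  ≈⇒Nullable⇔ A (ind-r p)     = ≈⇒Nullable⇔ A p

  Nullable-t⇒⊆ : ∀ {A} B → Nullable A (t B) → B ⊆ A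
  Nullable-t⇒⊆ (b ∷ B) (b∈A , _)  (here refl) = b∈A
  Nullable-t⇒⊆ (b ∷ B) (_ , ε∈tB) (there b∈B) = Nullable-t⇒⊆ B ε∈tB b∈B

  ⊆⇒Nullable-t : ∀ {A} B → B ⊆ A → Nullable A (t B)
  ⊆⇒Nullable-t []      _   = tt
  ⊆⇒Nullable-t (b ∷ B) B⊆A = B⊆A (here refl) , ⊆⇒Nullable-t B (B⊆A ∘ there)

  ≦⇒⊆ : {A B : List X} → t A ≦ t B → B ⊆ A
  ≦⇒⊆ {A} {B} tA≦tB =
    Nullable-t⇒⊆ B (Equivalence.to (≈⇒Nullable⇔ A tA≦tB) (inj₁ (⊆⇒Nullable-t A ⊆-refl)))

lemma12 : {X : Set} (A B : List X) → Unique A → Unique B → (S : Set) →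
    ((⟦ t B ⟧ (σ[_] {X} {S} A) []) ⇔ (B ⊆ A))
    × ((B ⊆ A) ⇔ (t A ≦ t B))
    × ((t A ≦ t B) ⇔ (t A ≲ t B))
lemma12 A B _ _ _ =
    ε∈⟦t⟧σ[ A ]⇔⊆
  , mk⇔ ⊆⇒≦ ≦⇒⊆
  , mk⇔ (⊆⇒≲ ∘ ≦⇒⊆) (⊆⇒≦ ∘ ≲⇒⊆)
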